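{- Let $\mathcal{B}=(G,S)$ be a blade, let $H_1, \ldots, H_t$ be vertex-disjoint graphs, and let $H$ be their union. Then the following are equivalent: (1) $H$ is a minor of $\mathcal{B}$; (2) there exist pairwise disjoint sets $S_1,\ldots, S_t \subseteq S$ such that $H_i$ is a minor of $\mathcal{B}[S_i]$ for every $1 \leq i \leq t$.
   Context: All graphs are finite and simple. A graph $H$ is a minor of $G$ if a graph isomorphic to $H$ can be obtained from a subgraph of $G$ by contracting edges. A blade is a pair $(G,S)$ where $G$ is a graph and $S\subsetneq V(G)$. For a positive integer $k$, $\mathrm{Fan}(G,S,k)$ is the graph obtained from $k$ disjoint copies of $G$ by identifying the corresponding copies of each vertex of $S$. A graph $H$ is a minor of the blade $(G,S)$ if $H$ is a minor of $\mathrm{Fan}(G,S,k)$ for some positive integer $k$. For $S'\subseteq S$, $\mathcal{B}[S']$ denotes the blade $(G-(S-S'),S')$. -}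

module Defs where

open import Data.Nat using (ℕ; suc)
open import Data.Fin using (Fin)
open import Data.Bool using (Bool; T; not; _∨_)
open import Data.Unit using (⊤; tt)
open import Data.Empty using (⊥)
open import Data.Product using (Σ; ∃; _×_; _,_; proj₁; proj₂)
open import Data.Sum using (_⊎_; inj₁; inj₂)
open import Relation.Nullary using (¬_)
open import Relation.Binary.PropositionalEquality using (_≡_; _≢_; refl; sym)
open import Relation.Binary.Construct.Closure.ReflexiveTransitive using (Star)
open import Function.Bundles using (_↔_; _⇔_; Inverse)
open import Function.Definitions using (Injective)

record Graph : Set₁ where
  field
    V      : Set
    E      : V → V → Set
    E-sym  : ∀ {a b} → E a b → E b a
    E-irr  : ∀ {a} → ¬ E a a
open Graph public

Finite : Graph → Set
Finite G = ∃ λ n → V G ↔ Fin n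

Subgraph : Graph → Graph → Set
Subgraph K G = Σ (V K → V G) λ f → Injective _≡_ _≡_ f × (∀ a b → E K a b → E G (f a) (f b))

-- L is (isomorphic to) the graph obtained from K by contracting the edge xy:
-- c : V K → V L is surjective, identifies exactly x and y, and the edges of L
-- are exactly the images of edges of K that are not loops.
ContractStep : Graph → Graph → Set
ContractStep K L =
  Σ (V K) λ x → Σ (V K) λ y → E K x y ×
  Σ (V K → V L) λ c →
    (∀ w → ∃ λ a → c a ≡ w) ×
    c x ≡ c y ×
    (∀ a b → c a ≡ c b → a ≡ b ⊎ (a ≡ x × b ≡ y) ⊎ (a ≡ y × b ≡ x)) ×
    (∀ u w → E L u w ⇔ (u ≢ w × Σ (V K) λ a → Σ (V K) λ b → c a ≡ u × c b ≡ w × E K a b))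

Iso : Graph → Graph → Set
Iso L H = Σ (V L ↔ V H) λ f → ∀ a b → E L a b ⇔ E H (Inverse.to f a) (Inverse.to f b)

Minor : Graph → Graph → Set₁
Minor H G = Σ Graph λ K → Σ Graph λ L → Subgraph K G × Star ContractStep K L × Iso L H

-- Fan(G,S,k): vertices of S once, vertices outside S in k copies.
module _ (G : Graph) (S : V G → Bool) (k : ℕ) where
  FanV : Set
  FanV = Σ (V G) (λ v → T (S v)) ⊎ (Fin k × Σ (V G) (λ v → T (not (S v))))

  π : FanV → V G
  π (inj₁ (v , _)) = v
  π (inj₂ (_ , (v , _))) = v

  Compat : FanV → FanV → Set
  Compat (inj₁ _) _ = ⊤
  Compat (inj₂ _) (inj₁ _) = ⊤
  Compat (inj₂ (i , _)) (inj₂ (j , _)) = i ≡ j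

  Compat-sym : ∀ p q → Compat p q → Compat q p
  Compat-sym (inj₁ _) (inj₁ _) _ = tt
  Compat-sym (inj₁ _) (inj₂ _) _ = tt
  Compat-sym (inj₂ _) (inj₁ _) _ = tt
  Compat-sym (inj₂ _) (inj₂ _) e = sym e

  Fan : Graph
  Fan = record
    { V = FanV
    ; E = λ p q → Compat p q × E G (π p) (π q)
    ; E-sym = λ {p} {q} (c , e) → Compat-sym p q c , E-sym G e
    ; E-irr = λ (_ , e) → E-irr G e
    }

BladeMinor : Graph → (G : Graph) → (V G → Bool) → Set₁
BladeMinor H G S = ∃ λ k → Minor H (Fan G S (suc k))

-- The blade B[S'] = (G - (S - S'), S') for a (decidable) S' ⊆ S.
module _ (G : Graph) (S S' : V G → Bool) where
  RestrGraph : Graph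
  RestrGraph = record
    { V = Σ (V G) (λ v → T (not (S v) ∨ S' v))
    ; E = λ a b → E G (proj₁ a) (proj₁ b)
    ; E-sym = E-sym G
    ; E-irr = E-irr G
    }

  RestrSet : V RestrGraph → Bool
  RestrSet a = S' (proj₁ a)

module _ (t : ℕ) (H : Fin t → Graph) where
  data UnionE : Σ (Fin t) (λ i → V (H i)) → Σ (Fin t) (λ i → V (H i)) → Set where
    edge : ∀ {i a b} → E (H i) a b → UnionE (i , a) (i , b)

  Union : Graph
  Union = record
    { V = Σ (Fin t) (λ i → V (H i))
    ; E = UnionE
    ; E-sym = λ { (edge {i} e) → edge (E-sym (H i) e) }
    ; E-irr = λ { (edge {i} e) → E-irr (H i) e }
    }

module Submission where

-- We work with minor models: H is a minor of X iff some subgraph K of X reduces to H,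
-- i.e. contracts edge by edge to a graph isomorphic to H (`Red K H`).  Reductions act
-- componentwise on disjoint unions (`Union-Red`), and a reduction K ⟶ H restricts to
-- the fibres of the induced labelling V(K) → {1,…,t}, giving Kᵢ ⟶ Hᵢ (`fibre-Red`).
-- (1) ⇒ (2), `blade-split`: for a model K ⊆ Fan(G,S,k) of H let Sᵢ be the shared
-- vertices occupied by the fibre Kᵢ.  Injectivity of the embedding makes the Sᵢ
-- disjoint and Kᵢ lies in the fan of B[Sᵢ]; Sᵢ is decidable because V(K) is enumerated
-- by pulling an enumeration of V(H) back along the contractions.
-- (2) ⇒ (1), `blade-merge`: embed the fans of the B[Sᵢ] into one fan of (G,S) using
-- disjoint blocks of copy indices; as the Sᵢ are disjoint, the models of the Hᵢ have
-- disjoint images and their union is a model of H.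

open import Defs
open import Data.Bool using (Bool; T; true; false; not; _∨_)
open import Data.Bool.Properties using (T-∨; T-irrelevant)
open import Data.Empty using (⊥; ⊥-elim)
open import Data.Fin using (Fin; zero; suc; inject₁; inject≤; combine)
import Data.Fin.Properties as Fin
open import Data.List using (List; _∷_; map; concatMap; allFin)
open import Data.List.Membership.Propositional using (_∈_; lose)
open import Data.List.Membership.Propositional.Properties using (∈-map⁺; ∈-allFin; ∈-concatMap⁺)
open import Data.List.Relation.Unary.Any using (Any; here; there; any?; satisfied)
import Data.List.Relation.Unary.Enumerates.Setoid.Properties as Enumerates
open import Data.Nat using (ℕ; zero; suc; _+_; _*_; _≤_; s≤s)
open import Data.Nat.Properties using (m≤m+n; m≤n+m; ≤-trans)
open import Data.Product using (Σ; ∃; _×_; _,_; proj₁; proj₂)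
open import Data.Sum using (_⊎_; inj₁; inj₂; swap) renaming (map to map⊎)
open import Data.Sum.Properties using (inj₁-injective; inj₂-injective; swap-involutive)
open import Data.Unit using (⊤; tt)
open import Function using (_∘′_)
open import Function.Bundles using (_⇔_; _↔_; _↠_; Inverse; Surjection; Equivalence; mk⇔; mk↔ₛ′)
open import Function.Definitions using (Injective)
open import Function.Properties.Inverse using (↔-sym; ↔⇒↠; ↔⇒↣)
open import Relation.Binary.Construct.Closure.ReflexiveTransitive using (Star; ε; _◅_; _◅◅_)
open import Relation.Binary.Definitions using (DecidableEquality)
open import Relation.Binary.PropositionalEquality
  using (setoid; _≡_; _≢_; refl; sym; trans; cong; cong₂; subst; subst₂)
open import Relation.Nullary using (¬_; Dec; yes; no)
open import Relation.Nullary.Decidable using (⌊_⌋; _×-dec_; toWitness; fromWitness)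
open import Axiom.UniquenessOfIdentityProofs using (module Decidable⇒UIP)

-- `Iso` and `ContractStep` are Σ-types from which the two graphs cannot be inferred;
-- these wrappers make them indices, so that chains `Star Step A B` can be formed.
record _≅_ (A B : Graph) : Set where
  constructor ⟨_⟩
  field iso : Iso A B

record Step (A B : Graph) : Set where
  constructor ⟪_⟫
  field step : ContractStep A B

ImageEdge : (A B : Graph) → (V A → V B) → V B → V B → Set
ImageEdge A B c u w = u ≢ w × Σ (V A) λ a → Σ (V A) λ b → c a ≡ u × c b ≡ w × E A a b

OnlyMerges : (A B : Graph) → (V A → V B) → V A → V A → Set
OnlyMerges A B c x y = ∀ a b → c a ≡ c b → a ≡ b ⊎ (a ≡ x × b ≡ y) ⊎ (a ≡ y × b ≡ x)

module _ {A B : Graph} (i : A ≅ B) where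
  ito : V A → V B
  ito = Inverse.to (proj₁ (_≅_.iso i))

  ifrom : V B → V A
  ifrom = Inverse.from (proj₁ (_≅_.iso i))

  ito-ifrom : ∀ y → ito (ifrom y) ≡ y
  ito-ifrom = Inverse.strictlyInverseˡ (proj₁ (_≅_.iso i))

  ifrom-ito : ∀ x → ifrom (ito x) ≡ x
  ifrom-ito = Inverse.strictlyInverseʳ (proj₁ (_≅_.iso i))

  ito-edge : ∀ {a b} → E A a b → E B (ito a) (ito b)
  ito-edge {a} {b} = Equivalence.to (proj₂ (_≅_.iso i) a b)

  ito-edge⁻ : ∀ {a b} → E B (ito a) (ito b) → E A a b
  ito-edge⁻ {a} {b} = Equivalence.from (proj₂ (_≅_.iso i) a b)

  ifrom-edge : ∀ {a b} → E B a b → E A (ifrom a) (ifrom b)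
  ifrom-edge e = ito-edge⁻ (subst₂ (E B) (sym (ito-ifrom _)) (sym (ito-ifrom _)) e)

  ito-injective : ∀ {a b} → ito a ≡ ito b → a ≡ b
  ito-injective {a} {b} eq = trans (sym (ifrom-ito a)) (trans (cong ifrom eq) (ifrom-ito b))

mkIso : ∀ {A B : Graph} (to : V A → V B) (from : V B → V A) →
  (∀ y → to (from y) ≡ y) → (∀ x → from (to x) ≡ x) →
  (∀ a b → E A a b → E B (to a) (to b)) → (∀ a b → E B (to a) (to b) → E A a b) → A ≅ B
mkIso to from to-from from-to preserves reflects =
  ⟨ mk↔ₛ′ to from to-from from-to , (λ a b → mk⇔ (preserves a b) (reflects a b)) ⟩

≅-refl : ∀ {A} → A ≅ A
≅-refl = mkIso (λ a → a) (λ a → a) (λ _ → refl) (λ _ → refl) (λ _ _ e → e) (λ _ _ e → e)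

≅-sym : ∀ {A B} → A ≅ B → B ≅ A
≅-sym {A} {B} i = mkIso (ifrom i) (ito i) (ifrom-ito i) (ito-ifrom i)
  (λ _ _ → ifrom-edge i)
  (λ a b e → subst₂ (E B) (ito-ifrom i a) (ito-ifrom i b) (ito-edge i e))

≅-trans : ∀ {A B C} → A ≅ B → B ≅ C → A ≅ C
≅-trans i j = mkIso (ito j ∘′ ito i) (ifrom i ∘′ ifrom j)
  (λ y → trans (cong (ito j) (ito-ifrom i _)) (ito-ifrom j y))
  (λ x → trans (cong (ifrom i) (ifrom-ito j _)) (ifrom-ito i x))
  (λ _ _ e → ito-edge j (ito-edge i e)) (λ _ _ e → ito-edge⁻ i (ito-edge⁻ j e))

≅-step : ∀ {A B C} → A ≅ B → Step B C → Step A C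
≅-step {A} {B} {C} i ⟪ (x , y , exy , c , surj , cxy , fib , ed) ⟫ =
  ⟪ (ifrom i x , ifrom i y , ifrom-edge i exy , c′ , surj′ , cxy′ , fib′ , ed′) ⟫
  where
  c′ : V A → V C
  c′ = c ∘′ ito i

  surj′ : ∀ w → ∃ λ a → c′ a ≡ w
  surj′ w = ifrom i (proj₁ (surj w)) , trans (cong c (ito-ifrom i _)) (proj₂ (surj w))

  cxy′ : c′ (ifrom i x) ≡ c′ (ifrom i y)
  cxy′ = trans (cong c (ito-ifrom i x)) (trans cxy (sym (cong c (ito-ifrom i y))))

  back : ∀ {a z} → ito i a ≡ z → a ≡ ifrom i z
  back {a} p = trans (sym (ifrom-ito i a)) (cong (ifrom i) p)

  fib′ : OnlyMerges A C c′ (ifrom i x) (ifrom i y)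
  fib′ a b eq with fib (ito i a) (ito i b) eq
  ... | inj₁ p = inj₁ (ito-injective i p)
  ... | inj₂ (inj₁ (p , q)) = inj₂ (inj₁ (back p , back q))
  ... | inj₂ (inj₂ (p , q)) = inj₂ (inj₂ (back p , back q))

  fromB : ∀ {u w} → ImageEdge B C c u w → ImageEdge A C c′ u w
  fromB (ne , a , b , ca , cb , eab) =
    ne , ifrom i a , ifrom i b , trans (cong c (ito-ifrom i a)) ca ,
    trans (cong c (ito-ifrom i b)) cb , ifrom-edge i eab

  toB : ∀ {u w} → ImageEdge A C c′ u w → ImageEdge B C c u w
  toB (ne , a , b , ca , cb , eab) = ne , ito i a , ito i b , ca , cb , ito-edge i eab

  ed′ : ∀ u w → E C u w ⇔ ImageEdge A C c′ u w
  ed′ u w = mk⇔ (fromB ∘′ Equivalence.to (ed u w)) (Equivalence.from (ed u w) ∘′ toB)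

record Red (A B : Graph) : Set₁ where
  constructor red
  field
    {mid} : Graph
    chain : Star Step A mid
    fin : mid ≅ B

≅-Red : ∀ {A B} → A ≅ B → Red A B
≅-Red i = red ε i

Red-refl : ∀ {A} → Red A A
Red-refl = ≅-Red ≅-refl

-- An isomorphism followed by contractions can be replaced by contractions followed
-- by an isomorphism; this is what makes `Red` transitive.
≅-Star : ∀ {A B C} → A ≅ B → Star Step B C → Red A C
≅-Star i ε = red ε i
≅-Star i (s ◅ ss) = red (≅-step i s ◅ ss) ≅-refl

Red-trans : ∀ {A B C} → Red A B → Red B C → Red A C
Red-trans (red ch₁ i₁) (red ch₂ i₂) with ≅-Star i₁ ch₂
... | red ch₃ i₃ = red (ch₁ ◅◅ ch₃) (≅-trans i₃ i₂)

stepMap : ∀ {A B} → Step A B → V A → V B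
stepMap ⟪ (_ , _ , _ , c , _) ⟫ = c

starMap : ∀ {A B} → Star Step A B → V A → V B
starMap ε a = a
starMap (s ◅ ss) a = starMap ss (stepMap s a)

redMap : ∀ {A B} → Red A B → V A → V B
redMap (red ch i) = ito i ∘′ starMap ch

Model : Graph → Graph → Set₁
Model H X = Σ Graph λ K → Subgraph K X × Red K H

minor⇒model : ∀ {H X} → Minor H X → Model H X
minor⇒model (K , L , sub , ch , j) = K , sub , red (wrap ch) ⟨ j ⟩
  where
  wrap : ∀ {A B} → Star ContractStep A B → Star Step A B
  wrap ε = ε
  wrap (s ◅ ss) = ⟪ s ⟫ ◅ wrap ss

model⇒minor : ∀ {H X} → Model H X → Minor H X
model⇒minor (K , sub , red ch j) = K , _ , sub , unwrap ch , _≅_.iso j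
  where
  unwrap : ∀ {A B} → Star Step A B → Star ContractStep A B
  unwrap ε = ε
  unwrap (⟪ s ⟫ ◅ ss) = s ◅ unwrap ss

Subgraph-trans : ∀ {A B C} → Subgraph A B → Subgraph B C → Subgraph A C
Subgraph-trans (f , f-inj , f-edge) (g , g-inj , g-edge) =
  g ∘′ f , f-inj ∘′ g-inj , λ a b e → g-edge (f a) (f b) (f-edge a b e)

E⊕ : (A C : Graph) → V A ⊎ V C → V A ⊎ V C → Set
E⊕ A C (inj₁ a) (inj₁ b) = E A a b
E⊕ A C (inj₁ _) (inj₂ _) = ⊥
E⊕ A C (inj₂ _) (inj₁ _) = ⊥
E⊕ A C (inj₂ a) (inj₂ b) = E C a b

_⊕_ : Graph → Graph → Graph
A ⊕ C = record
  { V = V A ⊎ V C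
  ; E = E⊕ A C
  ; E-sym = λ {p} {q} → sym⊕ p q
  ; E-irr = λ {p} → irr⊕ p
  }
  where
  sym⊕ : ∀ p q → E⊕ A C p q → E⊕ A C q p
  sym⊕ (inj₁ _) (inj₁ _) e = E-sym A e
  sym⊕ (inj₂ _) (inj₂ _) e = E-sym C e

  irr⊕ : ∀ p → E⊕ A C p p → ⊥
  irr⊕ (inj₁ _) e = E-irr A e
  irr⊕ (inj₂ _) e = E-irr C e

module ExtendLeft {A B : Graph} (C : Graph) (x y : V A) (c : V A → V B)
  (surj : ∀ w → ∃ λ a → c a ≡ w) (fib : OnlyMerges A B c x y)
  (ed : ∀ u w → E B u w ⇔ ImageEdge A B c u w) where

  c⊕ : V A ⊎ V C → V B ⊎ V C
  c⊕ = map⊎ c (λ z → z)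

  surj⊕ : ∀ w → ∃ λ a → c⊕ a ≡ w
  surj⊕ (inj₁ w) = inj₁ (proj₁ (surj w)) , cong inj₁ (proj₂ (surj w))
  surj⊕ (inj₂ z) = inj₂ z , refl

  fib⊕ : OnlyMerges (A ⊕ C) (B ⊕ C) c⊕ (inj₁ x) (inj₁ y)
  fib⊕ (inj₁ a) (inj₁ b) eq with fib a b (inj₁-injective eq)
  ... | inj₁ p = inj₁ (cong inj₁ p)
  ... | inj₂ (inj₁ (p , q)) = inj₂ (inj₁ (cong inj₁ p , cong inj₁ q))
  ... | inj₂ (inj₂ (p , q)) = inj₂ (inj₂ (cong inj₁ p , cong inj₁ q))
  fib⊕ (inj₂ a) (inj₂ b) refl = inj₁ refl

  edge⇒image : ∀ u w → E⊕ B C u w → ImageEdge (A ⊕ C) (B ⊕ C) c⊕ u w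
  edge⇒image (inj₁ u) (inj₁ w) e with Equivalence.to (ed u w) e
  ... | ne , a , b , p , q , eab =
    (λ eq → ne (inj₁-injective eq)) , inj₁ a , inj₁ b , cong inj₁ p , cong inj₁ q , eab
  edge⇒image (inj₂ u) (inj₂ w) e =
    (λ { refl → E-irr C e }) , inj₂ u , inj₂ w , refl , refl , e

  image⇒edge : ∀ u w → ImageEdge (A ⊕ C) (B ⊕ C) c⊕ u w → E⊕ B C u w
  image⇒edge _ _ (ne , inj₁ a , inj₁ b , refl , refl , eab) =
    Equivalence.from (ed (c a) (c b)) ((λ eq → ne (cong inj₁ eq)) , a , b , refl , refl , eab)
  image⇒edge _ _ (ne , inj₂ a , inj₂ b , refl , refl , eab) = eab

stepL : ∀ {A B C} → Step A B → Step (A ⊕ C) (B ⊕ C)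
stepL {C = C} ⟪ (x , y , exy , c , surj , cxy , fib , ed) ⟫ =
  ⟪ (inj₁ x , inj₁ y , exy , c⊕ , surj⊕ , cong inj₁ cxy , fib⊕ ,
     (λ u w → mk⇔ (edge⇒image u w) (image⇒edge u w))) ⟫
  where open ExtendLeft C x y c surj fib ed

≅-⊕ : ∀ {A B C D} → A ≅ B → C ≅ D → (A ⊕ C) ≅ (B ⊕ D)
≅-⊕ {A} {B} {C} {D} i j =
  mkIso (map⊎ (ito i) (ito j)) (map⊎ (ifrom i) (ifrom j)) to-from from-to preserves reflects
  where
  to-from : ∀ y → map⊎ (ito i) (ito j) (map⊎ (ifrom i) (ifrom j) y) ≡ y
  to-from (inj₁ y) = cong inj₁ (ito-ifrom i y)
  to-from (inj₂ y) = cong inj₂ (ito-ifrom j y)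
  from-to : ∀ x → map⊎ (ifrom i) (ifrom j) (map⊎ (ito i) (ito j) x) ≡ x
  from-to (inj₁ x) = cong inj₁ (ifrom-ito i x)
  from-to (inj₂ x) = cong inj₂ (ifrom-ito j x)
  preserves : ∀ a b → E⊕ A C a b → E⊕ B D (map⊎ (ito i) (ito j) a) (map⊎ (ito i) (ito j) b)
  preserves (inj₁ _) (inj₁ _) = ito-edge i
  preserves (inj₂ _) (inj₂ _) = ito-edge j
  reflects : ∀ a b → E⊕ B D (map⊎ (ito i) (ito j) a) (map⊎ (ito i) (ito j) b) → E⊕ A C a b
  reflects (inj₁ _) (inj₁ _) = ito-edge⁻ i
  reflects (inj₂ _) (inj₂ _) = ito-edge⁻ j

⊕-comm : ∀ {A C} → (A ⊕ C) ≅ (C ⊕ A)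
⊕-comm {A} {C} = mkIso swap swap swap-involutive swap-involutive preserves reflects
  where
  preserves : ∀ a b → E⊕ A C a b → E⊕ C A (swap a) (swap b)
  preserves (inj₁ _) (inj₁ _) e = e
  preserves (inj₂ _) (inj₂ _) e = e
  reflects : ∀ a b → E⊕ C A (swap a) (swap b) → E⊕ A C a b
  reflects (inj₁ _) (inj₁ _) e = e
  reflects (inj₂ _) (inj₂ _) e = e

Red-⊕ : ∀ {A B C D} → Red A B → Red C D → Red (A ⊕ C) (B ⊕ D)
Red-⊕ r₁ r₂ =
  Red-trans (left r₁) (Red-trans (≅-Red ⊕-comm) (Red-trans (left r₂) (≅-Red ⊕-comm)))
  where
  left : ∀ {A B C} → Red A B → Red (A ⊕ C) (B ⊕ C)
  left (red ch i) = red (stars ch) (≅-⊕ i ≅-refl)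
    where
    stars : ∀ {A B C} → Star Step A B → Star Step (A ⊕ C) (B ⊕ C)
    stars ε = ε
    stars (s ◅ ss) = stepL s ◅ stars ss

Union-split : ∀ t (H : Fin (suc t) → Graph) →
  Union (suc t) H ≅ (H zero ⊕ Union t (H ∘′ suc))
Union-split t H = mkIso to from to-from from-to preserves reflects
  where
  to : V (Union (suc t) H) → V (H zero) ⊎ V (Union t (H ∘′ suc))
  to (zero , a) = inj₁ a
  to (suc i , a) = inj₂ (i , a)
  from : V (H zero) ⊎ V (Union t (H ∘′ suc)) → V (Union (suc t) H)
  from (inj₁ a) = zero , a
  from (inj₂ (i , a)) = suc i , a
  to-from : ∀ y → to (from y) ≡ y
  to-from (inj₁ _) = refl
  to-from (inj₂ _) = refl
  from-to : ∀ x → from (to x) ≡ x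
  from-to (zero , _) = refl
  from-to (suc _ , _) = refl
  preserves : ∀ a b → E (Union (suc t) H) a b →
    E⊕ (H zero) (Union t (H ∘′ suc)) (to a) (to b)
  preserves (zero , _) (zero , _) (edge e) = e
  preserves (suc _ , _) (suc _ , _) (edge e) = edge e
  reflects : ∀ a b → E⊕ (H zero) (Union t (H ∘′ suc)) (to a) (to b) →
    E (Union (suc t) H) a b
  reflects (zero , _) (zero , _) e = edge e
  reflects (suc _ , _) (suc _ , _) (edge e) = edge e

Union-empty : ∀ (K L : Fin 0 → Graph) → Union 0 K ≅ Union 0 L
Union-empty K L = mkIso (λ { (() , _) }) (λ { (() , _) }) (λ { (() , _) }) (λ { (() , _) })
  (λ { (() , _) _ _ }) (λ { (() , _) _ _ })

Union-Red : ∀ t (K L : Fin t → Graph) → (∀ i → Red (K i) (L i)) →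
  Red (Union t K) (Union t L)
Union-Red zero K L _ = ≅-Red (Union-empty K L)
Union-Red (suc t) K L r =
  Red-trans (≅-Red (Union-split t K))
    (Red-trans (Red-⊕ (r zero) (Union-Red t (K ∘′ suc) (L ∘′ suc) (λ i → r (suc i))))
      (≅-Red (≅-sym (Union-split t L))))

Union-Subgraph : ∀ t (K : Fin t → Graph) {X : Graph} (g : ∀ i → Subgraph (K i) X) →
  (∀ i j a b → proj₁ (g i) a ≡ proj₁ (g j) b → i ≡ j) → Subgraph (Union t K) X
Union-Subgraph t K {X} g apart = G , G-injective , G-edge
  where
  G : V (Union t K) → V X
  G (i , a) = proj₁ (g i) a
  G-injective : ∀ {p q} → G p ≡ G q → p ≡ q
  G-injective {i , a} {j , b} eq with apart i j a b eq
  ... | refl = cong (i ,_) (proj₁ (proj₂ (g i)) eq)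
  G-edge : ∀ p q → E (Union t K) p q → E X (G p) (G q)
  G-edge (i , a) (_ , b) (edge e) = proj₂ (proj₂ (g i)) a b e

Fibre : (A : Graph) {n : ℕ} → (V A → Fin n) → Fin n → Graph
Fibre A h i = record
  { V = Σ (V A) (λ a → h a ≡ i)
  ; E = λ a b → E A (proj₁ a) (proj₁ b)
  ; E-sym = E-sym A
  ; E-irr = E-irr A
  }

-- Vertices of a fibre are determined by their underlying vertex (Fin has UIP).
fibre-≡ : ∀ {X : Set} {n} {h : X → Fin n} {i : Fin n} {a b : X} {p : h a ≡ i} {q : h b ≡ i} →
  a ≡ b → _≡_ {A = Σ X (λ x → h x ≡ i)} (a , p) (b , q)
fibre-≡ {p = p} {q} refl = cong (_ ,_) (Decidable⇒UIP.≡-irrelevant Fin._≟_ p q)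

Fibre-Subgraph : ∀ (A : Graph) {n} (h : V A → Fin n) i → Subgraph (Fibre A h i) A
Fibre-Subgraph A h i = proj₁ , (λ eq → fibre-≡ eq) , (λ _ _ e → e)

Union-fibre : ∀ t (H : Fin t → Graph) i → Fibre (Union t H) proj₁ i ≅ H i
Union-fibre t H i = mkIso to (λ a → (i , a) , refl) (λ _ → refl) from-to preserves reflects
  where
  to : V (Fibre (Union t H) proj₁ i) → V (H i)
  to ((_ , a) , refl) = a
  from-to : ∀ y → ((i , to y) , refl) ≡ y
  from-to ((_ , _) , refl) = refl
  preserves : ∀ a b → E (Fibre (Union t H) proj₁ i) a b → E (H i) (to a) (to b)
  preserves ((_ , _) , refl) ((_ , _) , refl) (edge e) = e
  reflects : ∀ a b → E (H i) (to a) (to b) → E (Fibre (Union t H) proj₁ i) a b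
  reflects ((_ , _) , refl) ((_ , _) , refl) e = edge e

module FibreOfStep {A B : Graph} (x y : V A) (exy : E A x y) (c : V A → V B)
  (surj : ∀ w → ∃ λ a → c a ≡ w) (cxy : c x ≡ c y) (fib : OnlyMerges A B c x y)
  (ed : ∀ u w → E B u w ⇔ ImageEdge A B c u w) {n : ℕ} (h : V B → Fin n) (i : Fin n) where

  FA FB : Graph
  FA = Fibre A (h ∘′ c) i
  FB = Fibre B h i

  cF : V FA → V FB
  cF (a , r) = c a , r

  pre : V FB → V FA
  pre (w , r) = proj₁ (surj w) , trans (cong h (proj₂ (surj w))) r

  cF-pre : ∀ w → cF (pre w) ≡ w
  cF-pre (w , _) = fibre-≡ (proj₂ (surj w))

  -- If x lies over i, so does y, and the fibre of B is the fibre of A with xy contracted.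
  module Inside (x-in : h (c x) ≡ i) where
    x̂ ŷ : V FA
    x̂ = x , x-in
    ŷ = y , trans (cong h (sym cxy)) x-in

    fibF : OnlyMerges FA FB cF x̂ ŷ
    fibF (a , _) (b , _) eq with fib a b (cong proj₁ eq)
    ... | inj₁ e = inj₁ (fibre-≡ e)
    ... | inj₂ (inj₁ (e₁ , e₂)) = inj₂ (inj₁ (fibre-≡ e₁ , fibre-≡ e₂))
    ... | inj₂ (inj₂ (e₁ , e₂)) = inj₂ (inj₂ (fibre-≡ e₁ , fibre-≡ e₂))

    edge⇒image : ∀ u w → E FB u w → ImageEdge FA FB cF u w
    edge⇒image (u , ru) (w , rw) e with Equivalence.to (ed u w) e
    ... | ne , a , b , ca , cb , eab =
      (λ eq → ne (cong proj₁ eq)) , (a , trans (cong h ca) ru) , (b , trans (cong h cb) rw) ,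
      fibre-≡ ca , fibre-≡ cb , eab

    image⇒edge : ∀ u w → ImageEdge FA FB cF u w → E FB u w
    image⇒edge (u , _) (w , _) (ne , (a , _) , (b , _) , ca , cb , eab) =
      Equivalence.from (ed u w)
        ((λ eq → ne (fibre-≡ eq)) , a , b , cong proj₁ ca , cong proj₁ cb , eab)

    step : Step FA FB
    step = ⟪ (x̂ , ŷ , exy , cF , (λ w → pre w , cF-pre w) , fibre-≡ cxy , fibF ,
              (λ u w → mk⇔ (edge⇒image u w) (image⇒edge u w))) ⟫

  -- Otherwise c is injective over i, and maps the fibre of A isomorphically.
  module Outside (x-out : h (c x) ≢ i) where
    c-injective : ∀ a b → h (c a) ≡ i → c a ≡ c b → a ≡ b
    c-injective a b r eq with fib a b eq
    ... | inj₁ e = e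
    ... | inj₂ (inj₁ (refl , _)) = ⊥-elim (x-out r)
    ... | inj₂ (inj₂ (refl , _)) = ⊥-elim (x-out (trans (cong h cxy) r))

    pre-cF : ∀ a → pre (cF a) ≡ a
    pre-cF (a , r) =
      fibre-≡ (c-injective _ a (trans (cong h (proj₂ (surj (c a)))) r) (proj₂ (surj (c a))))

    preserves : ∀ a b → E FA a b → E FB (cF a) (cF b)
    preserves (a , ra) (b , _) e =
      Equivalence.from (ed (c a) (c b))
        ((λ eq → E-irr A (subst (E A a) (sym (c-injective a b ra eq)) e)) , a , b , refl , refl , e)

    reflects : ∀ a b → E FB (cF a) (cF b) → E FA a b
    reflects (a , ra) (b , rb) e with Equivalence.to (ed (c a) (c b)) e
    ... | _ , a′ , b′ , p , q , e′ =
      subst₂ (E A) (c-injective a′ a (trans (cong h p) ra) p)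
                   (c-injective b′ b (trans (cong h q) rb) q) e′

    iso : FA ≅ FB
    iso = mkIso cF pre cF-pre pre-cF preserves reflects

fibre-step : ∀ {A B n} (s : Step A B) (h : V B → Fin n) (i : Fin n) →
  Red (Fibre A (h ∘′ stepMap s) i) (Fibre B h i)
fibre-step ⟪ (x , y , exy , c , surj , cxy , fib , ed) ⟫ h i with h (c x) Fin.≟ i
... | yes x-in = red (Inside.step x-in ◅ ε) ≅-refl
  where open FibreOfStep x y exy c surj cxy fib ed h i
... | no x-out = ≅-Red (Outside.iso x-out)
  where open FibreOfStep x y exy c surj cxy fib ed h i

fibre-≅ : ∀ {A B n} (j : A ≅ B) (h : V B → Fin n) (i : Fin n) →
  Fibre A (h ∘′ ito j) i ≅ Fibre B h i
fibre-≅ {A} {B} j h i = mkIso (λ { (a , r) → ito j a , r })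
  (λ { (b , r) → ifrom j b , trans (cong h (ito-ifrom j b)) r })
  (λ { (b , _) → fibre-≡ (ito-ifrom j b) }) (λ { (a , _) → fibre-≡ (ifrom-ito j a) })
  (λ _ _ → ito-edge j) (λ _ _ → ito-edge⁻ j)

fibre-Red : ∀ {A B n} (r : Red A B) (h : V B → Fin n) (i : Fin n) →
  Red (Fibre A (h ∘′ redMap r) i) (Fibre B h i)
fibre-Red (red ch j) h i = Red-trans (chain ch (h ∘′ ito j)) (≅-Red (fibre-≅ j h i))
  where
  chain : ∀ {A M} (ch : Star Step A M) (g : V M → Fin _) →
    Red (Fibre A (g ∘′ starMap ch) i) (Fibre M g i)
  chain ε g = Red-refl
  chain (s ◅ ss) g = Red-trans (fibre-step s (g ∘′ starMap ss) i) (chain ss g)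

Enumeration : Set → Set
Enumeration X = Σ (List X) λ xs → ∀ x → x ∈ xs

enum-↠ : ∀ {X Y : Set} → X ↠ Y → Enumeration X → Enumeration Y
enum-↠ f (xs , ∈xs) = map (Surjection.to f) xs , Enumerates.map⁺ (setoid _) (setoid _) f ∈xs

enum-Fin : ∀ {X : Set} {n} → X ↔ Fin n → Enumeration X
enum-Fin {n = n} f = enum-↠ (↔⇒↠ (↔-sym f)) (allFin n , ∈-allFin)

enum-Σ : ∀ t (P : Fin t → Set) → (∀ i → Enumeration (P i)) → Enumeration (Σ (Fin t) P)
enum-Σ t P e = concatMap column (allFin t) , complete
  where
  column : (i : Fin t) → List (Σ (Fin t) P)
  column i = map (i ,_) (proj₁ (e i))
  complete : ∀ p → p ∈ concatMap column (allFin t)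
  complete (i , a) = ∈-concatMap⁺ column (lose (∈-allFin i) (∈-map⁺ (i ,_) (proj₂ (e i) a)))

-- Every vertex of A is x, y, or the chosen preimage of its image, so an enumeration
-- of the contracted graph yields one of A.
enum-step : ∀ {A B} → Step A B → Enumeration (V B) → Enumeration (V A)
enum-step {A} {B} ⟪ (x , y , _ , c , surj , _ , fib , _) ⟫ (ws , ∈ws) = x ∷ y ∷ map pre ws , complete
  where
  pre : V B → V A
  pre w = proj₁ (surj w)
  complete : ∀ a → a ∈ (x ∷ y ∷ map pre ws)
  complete a with fib a (pre (c a)) (sym (proj₂ (surj (c a))))
  ... | inj₁ a≡pre = there (there (subst (_∈ map pre ws) (sym a≡pre) (∈-map⁺ pre (∈ws (c a)))))
  ... | inj₂ (inj₁ (a≡x , _)) = here a≡x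
  ... | inj₂ (inj₂ (a≡y , _)) = there (here a≡y)

enum-Red : ∀ {A B} → Red A B → Enumeration (V B) → Enumeration (V A)
enum-Red (red ch j) e = chain ch (enum-↠ (↔⇒↠ (↔-sym (proj₁ (_≅_.iso j)))) e)
  where
  chain : ∀ {A M} → Star Step A M → Enumeration (V M) → Enumeration (V A)
  chain ε e = e
  chain (s ◅ ss) e = enum-step s (chain ss e)

T-not⇒¬T : ∀ {b} → T (not b) → ¬ T b
T-not⇒¬T {false} _ ()

¬T⇒T-not : ∀ {b} → ¬ T b → T (not b)
¬T⇒T-not {false} _ = tt
¬T⇒T-not {true} ¬t = ¬t tt

module _ (G : Graph) (S : V G → Bool) (k : ℕ) where
  IsShared : V G → FanV G S k → Set
  IsShared v (inj₁ (w , _)) = w ≡ v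
  IsShared v (inj₂ _) = ⊥

  -- p is still a vertex of the fan of B[S′]: a private copy, or a shared vertex of S′.
  Survives : (V G → Bool) → FanV G S k → Set
  Survives S′ (inj₁ (v , _)) = T (S′ v)
  Survives S′ (inj₂ _) = ⊤

relabel : ∀ (G : Graph) (S : V G → Bool) {k n} → (Fin k → Fin n) → FanV G S k → FanV G S n
relabel G S κ (inj₁ s) = inj₁ s
relabel G S κ (inj₂ (m , w)) = inj₂ (κ m , w)

relabel-Subgraph : ∀ (G : Graph) (S : V G → Bool) {k n} (κ : Fin k → Fin n) →
  Injective _≡_ _≡_ κ → Subgraph (Fan G S k) (Fan G S n)
relabel-Subgraph G S {k} {n} κ κ-injective = relabel G S κ , injective , preserves
  where
  injective : Injective _≡_ _≡_ (relabel G S κ)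
  injective {inj₁ _} {inj₁ _} eq = cong inj₁ (inj₁-injective eq)
  injective {inj₂ (m , w)} {inj₂ (m′ , w′)} eq
    with κ-injective (cong proj₁ (inj₂-injective eq)) | cong proj₂ (inj₂-injective eq)
  ... | refl | refl = refl
  preserves : ∀ p q → E (Fan G S k) p q → E (Fan G S n) (relabel G S κ p) (relabel G S κ q)
  preserves (inj₁ _) (inj₁ _) e = e
  preserves (inj₁ _) (inj₂ _) e = e
  preserves (inj₂ _) (inj₁ _) e = e
  preserves (inj₂ _) (inj₂ _) (same , e) = cong κ same , e

module RestrictedFan (G : Graph) (S S′ : V G → Bool) (S′⊆S : ∀ v → T (S′ v) → T (S v))
  (k : ℕ) where
  R : Graph
  R = RestrGraph G S S′

  RS : V R → Bool
  RS = RestrSet G S S′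

  outside-S : ∀ {v} → T (not (S v) ∨ S′ v) → T (not (S′ v)) → T (not (S v))
  outside-S o ns′ with Equivalence.to T-∨ o
  ... | inj₁ ns = ns
  ... | inj₂ s′ = ⊥-elim (T-not⇒¬T ns′ s′)

  forget : FanV R RS k → FanV G S k
  forget (inj₁ ((v , _) , s′)) = inj₁ (v , S′⊆S v s′)
  forget (inj₂ (m , ((v , o) , ns′))) = inj₂ (m , (v , outside-S o ns′))

  forget-injective : Injective _≡_ _≡_ forget
  forget-injective {inj₁ ((v , o) , s′)} {inj₁ ((_ , o′) , s″)} eq
    with refl ← cong proj₁ (inj₁-injective eq) =
    cong₂ (λ o s′ → inj₁ ((v , o) , s′)) (T-irrelevant o o′) (T-irrelevant s′ s″)
  forget-injective {inj₂ (m , ((v , o) , ns′))} {inj₂ (_ , ((_ , o′) , ns″))} eq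
    with refl ← cong proj₁ (inj₂-injective eq)
       | refl ← cong (proj₁ ∘′ proj₂) (inj₂-injective eq) =
    cong₂ (λ o ns′ → inj₂ (m , ((v , o) , ns′))) (T-irrelevant o o′) (T-irrelevant ns′ ns″)

  forget-preserves : ∀ p q → E (Fan R RS k) p q → E (Fan G S k) (forget p) (forget q)
  forget-preserves (inj₁ _) (inj₁ _) e = e
  forget-preserves (inj₁ _) (inj₂ _) e = e
  forget-preserves (inj₂ _) (inj₁ _) e = e
  forget-preserves (inj₂ _) (inj₂ _) e = e

  forget-reflects : ∀ p q → E (Fan G S k) (forget p) (forget q) → E (Fan R RS k) p q
  forget-reflects (inj₁ _) (inj₁ _) e = e
  forget-reflects (inj₁ _) (inj₂ _) e = e
  forget-reflects (inj₂ _) (inj₁ _) e = e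
  forget-reflects (inj₂ _) (inj₂ _) e = e

  forget-Subgraph : Subgraph (Fan R RS k) (Fan G S k)
  forget-Subgraph = forget , forget-injective , forget-preserves

  lift : (p : FanV G S k) → Survives G S k S′ p → FanV R RS k
  lift (inj₁ (v , _)) s′ = inj₁ ((v , Equivalence.from T-∨ (inj₂ s′)) , s′)
  lift (inj₂ (m , (v , ns))) _ =
    inj₂ (m , ((v , Equivalence.from T-∨ (inj₁ ns)) , ¬T⇒T-not (T-not⇒¬T ns ∘′ S′⊆S v)))

  forget-lift : ∀ p (sp : Survives G S k S′ p) → forget (lift p sp) ≡ p
  forget-lift (inj₁ (v , _)) _ = cong (λ s → inj₁ (v , s)) (T-irrelevant _ _)
  forget-lift (inj₂ (m , (v , _))) _ = cong (λ ns → inj₂ (m , (v , ns))) (T-irrelevant _ _)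

  lift-Subgraph : ∀ {K} (f : Subgraph K (Fan G S k)) →
    (∀ a → Survives G S k S′ (proj₁ f a)) → Subgraph K (Fan R RS k)
  lift-Subgraph {K} (f , f-injective , f-edge) survives = F , F-injective , F-edge
    where
    F : V K → FanV R RS k
    F a = lift (f a) (survives a)
    forget-F : ∀ a → forget (F a) ≡ f a
    forget-F a = forget-lift (f a) (survives a)
    F-injective : Injective _≡_ _≡_ F
    F-injective {a} {b} eq =
      f-injective (trans (sym (forget-F a)) (trans (cong forget eq) (forget-F b)))
    F-edge : ∀ a b → E K a b → E (Fan R RS k) (F a) (F b)
    F-edge a b e = forget-reflects (F a) (F b)
      (subst₂ (E (Fan G S k)) (sym (forget-F a)) (sym (forget-F b)) (f-edge a b e))

-- Membership is decidable since X is enumerated and V(G) discrete.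
module SharedVertices {G : Graph} (_≟_ : DecidableEquality (V G)) (S : V G → Bool)
  {k t : ℕ} {X : Set} (xs : Enumeration X) (label : X → Fin t)
  (place : X → FanV G S k) (place-injective : Injective _≡_ _≡_ place) where

  shared? : ∀ v p → Dec (IsShared G S k v p)
  shared? v (inj₁ (w , _)) = w ≟ v
  shared? v (inj₂ _) = no λ ()

  shared⇒S : ∀ {v} p → IsShared G S k v p → T (S v)
  shared⇒S (inj₁ (_ , s)) refl = s

  shared-unique : ∀ {v} p q → IsShared G S k v p → IsShared G S k v q → p ≡ q
  shared-unique (inj₁ (_ , s)) (inj₁ (_ , s′)) refl refl =
    cong (λ s → inj₁ (_ , s)) (T-irrelevant s s′)

  Uses : Fin t → V G → X → Set
  Uses i v a = label a ≡ i × IsShared G S k v (place a)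

  used? : ∀ i v → Dec (Any (Uses i v) (proj₁ xs))
  used? i v = any? (λ a → (label a Fin.≟ i) ×-dec shared? v (place a)) (proj₁ xs)

  Ss : Fin t → V G → Bool
  Ss i v = ⌊ used? i v ⌋

  Ss-witness : ∀ {i v} → T (Ss i v) → ∃ (Uses i v)
  Ss-witness {i} {v} u = satisfied (toWitness {a? = used? i v} u)

  Ss-intro : ∀ {i v a} → Uses i v a → T (Ss i v)
  Ss-intro {i} {v} {a} u = fromWitness {a? = used? i v} (lose (proj₂ xs a) u)

  Ss⊆S : ∀ i v → T (Ss i v) → T (S v)
  Ss⊆S i v u with a , _ , sh ← Ss-witness u = shared⇒S (place a) sh

  -- Two components cannot use the same shared vertex, since place is injective.
  Ss-disjoint : ∀ i j → i ≢ j → ∀ v → T (Ss i v) → T (Ss j v) → ⊥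
  Ss-disjoint i j i≢j v uᵢ uⱼ
    with a , la , sa ← Ss-witness uᵢ | b , lb , sb ← Ss-witness uⱼ =
    i≢j (trans (sym la) (trans (cong label (place-injective (shared-unique _ _ sa sb))) lb))

  Ss-covers : ∀ i a → label a ≡ i → Survives G S k (Ss i) (place a)
  Ss-covers i a la with place a in eq
  ... | inj₁ (v , _) = Ss-intro (la , subst (IsShared G S k v) (sym eq) refl)
  ... | inj₂ _ = tt

SplitsInto : (G : Graph) → (V G → Bool) → (t : ℕ) → (Fin t → Graph) → Set₁
SplitsInto G S t H =
  Σ (Fin t → V G → Bool) λ Ss →
    (∀ i v → T (Ss i v) → T (S v)) ×
    (∀ i j → i ≢ j → ∀ v → T (Ss i v) → T (Ss j v) → ⊥) ×
    (∀ i → BladeMinor (H i) (RestrGraph G S (Ss i)) (RestrSet G S (Ss i)))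

blade-split : ∀ (G : Graph) → DecidableEquality (V G) → (S : V G → Bool) →
  ∀ t (H : Fin t → Graph) → Enumeration (V (Union t H)) →
  BladeMinor (Union t H) G S → SplitsInto G S t H
blade-split G _≟_ S t H enumH (k , minor)
  with K , f , r ← minor⇒model {Union t H} {Fan G S (suc k)} minor =
  Ss , Ss⊆S , Ss-disjoint , component
  where
  -- the component of H into which a vertex of the model is contracted
  label : V K → Fin t
  label = proj₁ ∘′ redMap r

  open SharedVertices {G} _≟_ S (enum-Red r enumH) label (proj₁ f) (proj₁ (proj₂ f))

  component : ∀ i → BladeMinor (H i) (RestrGraph G S (Ss i)) (RestrSet G S (Ss i))
  component i = k , model⇒minor {H i} {Fan R RS (suc k)} (Kᵢ , embedding , reduction)
    where
    open RestrictedFan G S (Ss i) (Ss⊆S i) (suc k)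
    Kᵢ : Graph
    Kᵢ = Fibre K label i
    embedding : Subgraph Kᵢ (Fan R RS (suc k))
    embedding =
      lift-Subgraph {Kᵢ} (Subgraph-trans {Kᵢ} {K} {Fan G S (suc k)} (Fibre-Subgraph K label i) f)
        (λ { (a , la) → Ss-covers i a la })
    reduction : Red Kᵢ (H i)
    reduction = Red-trans (fibre-Red r proj₁ i) (≅-Red (Union-fibre t H i))

total : ∀ t → (Fin t → ℕ) → ℕ
total zero _ = 0
total (suc t) ks = ks zero + total t (ks ∘′ suc)

≤-total : ∀ t (ks : Fin t → ℕ) i → ks i ≤ total t ks
≤-total (suc t) ks zero = m≤m+n (ks zero) _
≤-total (suc t) ks (suc i) = ≤-trans (≤-total t (ks ∘′ suc) i) (m≤n+m _ (ks zero))

-- Copy indices of the i-th of t fans with ks i + 1 copies go to the i-th of t + 1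
-- blocks of size B + 1 (B = total t ks); the spare block keeps the count positive.
slot : ∀ t (ks : Fin t → ℕ) i → Fin (suc (ks i)) → Fin (suc t * suc (total t ks))
slot t ks i m = combine (inject₁ i) (inject≤ m (s≤s (≤-total t ks i)))

slot-injective : ∀ t ks i → Injective _≡_ _≡_ (slot t ks i)
slot-injective t ks i {m} {m′} eq =
  Fin.inject≤-injective _ _ m m′ (Fin.combine-injectiveʳ (inject₁ i) _ (inject₁ i) _ eq)

slot-apart : ∀ t ks i j m m′ → slot t ks i m ≡ slot t ks j m′ → i ≡ j
slot-apart t ks i j m m′ eq =
  Fin.inject₁-injective (Fin.combine-injectiveˡ (inject₁ i) _ (inject₁ j) _ eq)

blade-merge : ∀ (G : Graph) (S : V G → Bool) t (H : Fin t → Graph) →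
  SplitsInto G S t H → BladeMinor (Union t H) G S
blade-merge G S t H (Ss , Ss⊆S , disjoint , minors) =
  total t ks + t * suc (total t ks) ,
  model⇒minor {Union t H} {Fan G S N}
    (Union t K , Union-Subgraph t K {Fan G S N} placeᵢ apart , Union-Red t K H reductionᵢ)
  where
  ks : Fin t → ℕ
  ks i = proj₁ (minors i)

  N : ℕ
  N = suc t * suc (total t ks)

  module Fanᵢ (i : Fin t) = RestrictedFan G S (Ss i) (Ss⊆S i) (suc (ks i))

  Bladeᵢ : Fin t → Graph
  Bladeᵢ i = Fan (Fanᵢ.R i) (Fanᵢ.RS i) (suc (ks i))

  modelᵢ : ∀ i → Model (H i) (Bladeᵢ i)
  modelᵢ i = minor⇒model {H i} {Bladeᵢ i} (proj₂ (minors i))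

  K : Fin t → Graph
  K i = proj₁ (modelᵢ i)

  subgraphᵢ : ∀ i → Subgraph (K i) (Bladeᵢ i)
  subgraphᵢ i = proj₁ (proj₂ (modelᵢ i))

  reductionᵢ : ∀ i → Red (K i) (H i)
  reductionᵢ i = proj₂ (proj₂ (modelᵢ i))

  embedᵢ : ∀ i → Subgraph (Bladeᵢ i) (Fan G S N)
  embedᵢ i = Subgraph-trans {Bladeᵢ i} {Fan G S (suc (ks i))} {Fan G S N}
    (Fanᵢ.forget-Subgraph i) (relabel-Subgraph G S (slot t ks i) (slot-injective t ks i))

  placeᵢ : ∀ i → Subgraph (K i) (Fan G S N)
  placeᵢ i = Subgraph-trans {K i} {Bladeᵢ i} {Fan G S N} (subgraphᵢ i) (embedᵢ i)

  -- Distinct fans meet neither in a shared vertex (the Sᵢ are disjoint) nor in a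
  -- private copy (their blocks of copy indices are disjoint).
  embed-apart : ∀ i j p q → proj₁ (embedᵢ i) p ≡ proj₁ (embedᵢ j) q → i ≡ j
  embed-apart i j (inj₁ ((v , _) , sᵢ)) (inj₁ ((_ , _) , sⱼ)) eq
    with refl ← cong proj₁ (inj₁-injective eq) | i Fin.≟ j
  ... | yes i≡j = i≡j
  ... | no i≢j = ⊥-elim (disjoint i j i≢j v sᵢ sⱼ)
  embed-apart i j (inj₂ (m , _)) (inj₂ (m′ , _)) eq =
    slot-apart t ks i j m m′ (cong proj₁ (inj₂-injective eq))

  apart : ∀ i j a b → proj₁ (placeᵢ i) a ≡ proj₁ (placeᵢ j) b → i ≡ j
  apart i j a b = embed-apart i j (proj₁ (subgraphᵢ i) a) (proj₁ (subgraphᵢ j) b)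

lemma2p6 : (G : Graph) → Finite G → (S : V G → Bool) → (∃ λ v → S v ≡ false) →
    (t : ℕ) → (H : Fin t → Graph) → (∀ i → Finite (H i)) →
    BladeMinor (Union t H) G S ⇔
      (Σ (Fin t → V G → Bool) λ Ss →
        (∀ i v → T (Ss i v) → T (S v)) ×
        (∀ i j → i ≢ j → ∀ v → T (Ss i v) → T (Ss j v) → ⊥) ×
        (∀ i → BladeMinor (H i) (RestrGraph G S (Ss i)) (RestrSet G S (Ss i))))
lemma2p6 G finG S _ t H finH = mk⇔ (blade-split G _≟_ S t H enumH) (blade-merge G S t H)
  where
  _≟_ : DecidableEquality (V G)
  _≟_ = Fin.inj⇒≟ (↔⇒↣ (proj₂ finG))

  enumH : Enumeration (V (Union t H))
  enumH = enum-Σ t (λ i → V (H i)) (λ i → enum-Fin (proj₂ (finH i)))
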